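{- Let $r\ge 2$ and $n\ge 1$ be integers and let $N=m/r^n$ where $m$ is an integer with $1\le m\le r^n-1$ and $m$ not divisible by $r$. Then $N$ has at least $n+1$ distinct GFN codes of radix $r$ and resolution $n$.
   Context: A GFN (generic fractional number) code of radix $r$ and resolution $n$ of a number $N$ is a tuple $(A_0,A_1,\dots,A_n)$ of integers with $A_0\in\{0,1\}$ and $A_j\in\{ -(r-1),\dots,-1,0,1,\dots,r-1\}$ for $1\le j\le n$, such that $N=A_0+\sum_{j=1}^{n}A_jr^{ -j}$. -}

module Defs where

open import Data.Nat as ℕ using (ℕ; zero; suc; _^_)
open import Data.Integer as ℤ using (ℤ; +_)
open import Data.Rational using (ℚ; _/_; _+_; _*_; 0ℚ)
open import Data.Vec using (Vec; []; _∷_)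
open import Data.Fin using (Fin)
open import Data.Product using (_×_)
open import Data.Sum using (_⊎_)
open import Relation.Binary.PropositionalEquality using (_≡_)

-- The rational number 1 / d (defined as 0 when d = 0; only used with d = r ^ j, r ≥ 2).
inv : ℕ → ℚ
inv zero    = 0ℚ
inv (suc d) = + 1 / suc d

fracSum : (r k : ℕ) → ∀ {len} → Vec ℤ len → ℚ
fracSum r k []       = 0ℚ
fracSum r k (a ∷ as) = (a / 1) * inv (r ^ k) + fracSum r (suc k) as

gfnValue : (r : ℕ) → ∀ {n} → Vec ℤ (suc n) → ℚ
gfnValue r (a₀ ∷ as) = (a₀ / 1) + fracSum r 1 as

DigitOK : ℕ → ℤ → Set
DigitOK r a = (ℤ.- (+ (r ℕ.∸ 1)) ℤ.≤ a) × (a ℤ.≤ + (r ℕ.∸ 1))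

data AllV {A : Set} (P : A → Set) : ∀ {k} → Vec A k → Set where
  []  : AllV P []
  _∷_ : ∀ {k x} {xs : Vec A k} → P x → AllV P xs → AllV P (x ∷ xs)

LeadOK : ℤ → Set
LeadOK a = (a ≡ + 0) ⊎ (a ≡ + 1)

IsGFNCode : (r n : ℕ) → ℚ → Vec ℤ (suc n) → Set
IsGFNCode r n N (a₀ ∷ as) = LeadOK a₀ × AllV (DigitOK r) as × (gfnValue r (a₀ ∷ as) ≡ N)

ratio : ℕ → ℕ → ℕ → ℚ
ratio m r n = (+ m / 1) * inv (r ^ n)

-- Write m = q r + d with 0 ≤ d < r. The last digit Aₙ of a code of m / rⁿ is congruent to m
-- modulo r, so it is d, or d − r when d ≠ 0; deleting it leaves a code of q / rⁿ⁻¹, resp.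
-- of (q + 1) / rⁿ⁻¹. Hence, when r ∤ m, the codes of m / rⁿ are at least as many as those of
-- q / rⁿ⁻¹ and of (q + 1) / rⁿ⁻¹ together. Every 0 ≤ m ≤ rⁿ has a code, and one of the
-- consecutive numbers q, q + 1 is again not divisible by r, so induction on n gives n + 1 codes.
module Submission where

open import Defs
open import Data.Nat using (ℕ; suc; _≤_; _^_; _∸_)
open import Data.Nat.Divisibility using (_∣_)
open import Data.Vec using (Vec)
open import Data.List using (List; length)
open import Data.List.Relation.Unary.All using (All)
open import Data.List.Relation.Unary.Unique.Propositional using (Unique)
open import Data.Integer using (ℤ)
open import Data.Product using (Σ; _×_)
open import Relation.Nullary using (¬_)

open import Data.Empty using (⊥-elim)
open import Data.Integer as ℤ using (+_; -[1+_]; -≤+; -≤-; +≤+)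
import Data.Integer.Properties as ℤP
open import Data.Integer.Tactic.RingSolver using (solve-∀)
open import Data.List using ([]; _∷_; [_]; map; _++_)
open import Data.List.Membership.Propositional.Properties using (∈-map⁻)
open import Data.List.Properties using (length-++; length-map)
open import Data.List.Relation.Binary.Disjoint.Propositional using (Disjoint)
import Data.List.Relation.Unary.All as All
import Data.List.Relation.Unary.All.Properties as All
import Data.List.Relation.Unary.AllPairs as AllPairs
import Data.List.Relation.Unary.Unique.Propositional.Properties as Unique
open import Data.Nat as ℕ using (zero; z≤n; s≤s; _<_; NonZero)
open import Data.Nat.DivMod using (_/_; _%_; m≡m%n+[m/n]*n; m%n<n; m*n/n≡m; /-monoˡ-≤; m<n*o⇒m/o<n)
open import Data.Nat.Divisibility using (_∣?_; m∣m*n; ∣m+n∣m⇒∣n; ∣1⇒≡1; m%n≡0⇒n∣m)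
import Data.Nat.Properties as ℕP
open import Data.Product using (_,_)
open import Data.Rational as ℚ using (toℚᵘ)
import Data.Rational.Properties as ℚP
import Data.Rational.Unnormalised as ℚᵘ
open import Data.Rational.Unnormalised using (mkℚᵘ; *≡*) renaming (_≃_ to _≃ᵘ_)
import Data.Rational.Unnormalised.Properties as ℚᵘP
open import Data.Sum using (inj₁; inj₂)
open import Data.Vec using ([]; _∷_; _∷ʳ_; head; tail)
open import Data.Vec.Properties using (∷ʳ-injectiveˡ; ∷ʳ-injectiveʳ)
open import Function using (_∘_)
open import Relation.Binary.PropositionalEquality hiding ([_])
open import Relation.Nullary using (yes; no)

toℚᵘ-/ : ∀ p n → toℚᵘ (p ℚ./ suc n) ≃ᵘ mkℚᵘ p n
toℚᵘ-/ p n = ℚP.toℚᵘ-fromℚᵘ (mkℚᵘ p n)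

/-cross : ∀ p q a b .{{_ : NonZero a}} .{{_ : NonZero b}} →
          p ℤ.* + b ≡ q ℤ.* + a → p ℚ./ a ≡ q ℚ./ b
/-cross p q (suc a-1) (suc b-1) eq = ℚP.toℚᵘ-injective (begin
  toℚᵘ (p ℚ./ suc a-1) ≈⟨ toℚᵘ-/ p a-1 ⟩
  mkℚᵘ p a-1           ≈⟨ *≡* eq ⟩
  mkℚᵘ q b-1           ≈⟨ ℚᵘP.≃-sym (toℚᵘ-/ q b-1) ⟩
  toℚᵘ (q ℚ./ suc b-1) ∎)
  where open ℚᵘP.≃-Reasoning

/-+-/ : ∀ p q n .{{_ : NonZero n}} → p ℚ./ n ℚ.+ q ℚ./ n ≡ (p ℤ.+ q) ℚ./ n
/-+-/ p q n@(suc n-1) = ℚP.toℚᵘ-injective (begin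
  toℚᵘ (p ℚ./ n ℚ.+ q ℚ./ n)         ≈⟨ ℚP.toℚᵘ-homo-+ (p ℚ./ n) (q ℚ./ n) ⟩
  toℚᵘ (p ℚ./ n) ℚᵘ.+ toℚᵘ (q ℚ./ n) ≈⟨ ℚᵘP.+-cong (toℚᵘ-/ p n-1) (toℚᵘ-/ q n-1) ⟩
  mkℚᵘ p n-1 ℚᵘ.+ mkℚᵘ q n-1         ≈⟨ *≡* (common-denominator (+ n)) ⟩
  mkℚᵘ (p ℤ.+ q) n-1                 ≈⟨ ℚᵘP.≃-sym (toℚᵘ-/ (p ℤ.+ q) n-1) ⟩
  toℚᵘ ((p ℤ.+ q) ℚ./ n)             ∎)
  where
  open ℚᵘP.≃-Reasoning
  common-denominator : ∀ d → (p ℤ.* d ℤ.+ q ℤ.* d) ℤ.* d ≡ (p ℤ.+ q) ℤ.* (d ℤ.* d)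
  common-denominator d =
    trans (cong (ℤ._* d) (sym (ℤP.*-distribʳ-+ d p q))) (ℤP.*-assoc (p ℤ.+ q) d d)

/1-*-/ : ∀ p q n .{{_ : NonZero n}} → (p ℚ./ 1) ℚ.* (q ℚ./ n) ≡ (p ℤ.* q) ℚ./ n
/1-*-/ p q n@(suc n-1) = ℚP.toℚᵘ-injective (begin
  toℚᵘ ((p ℚ./ 1) ℚ.* (q ℚ./ n))     ≈⟨ ℚP.toℚᵘ-homo-* (p ℚ./ 1) (q ℚ./ n) ⟩
  toℚᵘ (p ℚ./ 1) ℚᵘ.* toℚᵘ (q ℚ./ n) ≈⟨ ℚᵘP.*-cong (toℚᵘ-/ p 0) (toℚᵘ-/ q n-1) ⟩
  mkℚᵘ p 0 ℚᵘ.* mkℚᵘ q n-1           ≡⟨ cong (mkℚᵘ (p ℤ.* q)) (ℕP.+-identityʳ n-1) ⟩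
  mkℚᵘ (p ℤ.* q) n-1                 ≈⟨ ℚᵘP.≃-sym (toℚᵘ-/ (p ℤ.* q) n-1) ⟩
  toℚᵘ ((p ℤ.* q) ℚ./ n)             ∎)
  where open ℚᵘP.≃-Reasoning

inv≡1/ : ∀ n .{{_ : NonZero n}} → inv n ≡ + 1 ℚ./ n
inv≡1/ (suc n) = refl

inv-split : ∀ a b .{{_ : NonZero a}} .{{_ : NonZero b}} → inv a ≡ (+ b ℚ./ 1) ℚ.* inv (a ℕ.* b)
inv-split a@(suc _) b@(suc _) = begin
  inv a                               ≡⟨ inv≡1/ a ⟩
  + 1 ℚ./ a                           ≡⟨ /-cross (+ 1) (+ b ℤ.* + 1) a (a ℕ.* b) cross ⟩
  (+ b ℤ.* + 1) ℚ./ (a ℕ.* b)         ≡⟨ sym (/1-*-/ (+ b) (+ 1) (a ℕ.* b)) ⟩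
  (+ b ℚ./ 1) ℚ.* (+ 1 ℚ./ (a ℕ.* b)) ≡⟨ cong ((+ b ℚ./ 1) ℚ.*_) (sym (inv≡1/ (a ℕ.* b))) ⟩
  (+ b ℚ./ 1) ℚ.* inv (a ℕ.* b)       ∎
  where
  open ≡-Reasoning
  commute : ∀ x y → + 1 ℤ.* (x ℤ.* y) ≡ (y ℤ.* + 1) ℤ.* x
  commute = solve-∀
  cross : + 1 ℤ.* + (a ℕ.* b) ≡ (+ b ℤ.* + 1) ℤ.* + a
  cross = trans (cong (+ 1 ℤ.*_) (ℤP.pos-* a b)) (commute (+ a) (+ b))

module _ (r : ℕ) .{{_ : NonZero r}} where

  /-≤-^ : ∀ {x} n → x ≤ r ^ suc n → x / r ≤ r ^ n
  /-≤-^ n x≤ = ℕP.≤-trans (/-monoˡ-≤ r x≤)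
    (ℕP.≤-reflexive (trans (cong (_/ r) (ℕP.*-comm r (r ^ n))) (m*n/n≡m (r ^ n) r)))

  /-<-^ : ∀ {x} n → x < r ^ suc n → x / r < r ^ n
  /-<-^ {x} n x< = m<n*o⇒m/o<n (subst (x <_) (ℕP.*-comm r (r ^ n)) x<)

≤-^-∤⇒<-^ : ∀ {r x} n → x ≤ r ^ suc n → ¬ r ∣ x → x < r ^ suc n
≤-^-∤⇒<-^ {r} n x≤ r∤x with ℕP.m≤n⇒m<n∨m≡n x≤
... | inj₁ x< = x<
... | inj₂ refl = ⊥-elim (r∤x (m∣m*n (r ^ n)))

AllV-∷ʳ : ∀ {A : Set} {P : A → Set} {k} {xs : Vec A k} {x} → AllV P xs → P x → AllV P (xs ∷ʳ x)
AllV-∷ʳ []       px = px ∷ []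
AllV-∷ʳ (p ∷ ps) px = p ∷ AllV-∷ʳ ps px

module Radix (r : ℕ) .{{_ : NonZero r}} where

  horner : ∀ {len} → Vec ℤ len → ℤ
  horner []                 = + 0
  horner {suc len} (a ∷ as) = a ℤ.* + (r ^ len) ℤ.+ horner as

  horner-∷ʳ : ∀ {len} (v : Vec ℤ len) a → horner (v ∷ʳ a) ≡ horner v ℤ.* + r ℤ.+ a
  horner-∷ʳ [] a = trans (ℤP.+-identityʳ _) (trans (ℤP.*-identityʳ a) (sym (ℤP.+-identityˡ a)))
  horner-∷ʳ {suc len} (b ∷ v) a = begin
    b ℤ.* + (r ^ suc len) ℤ.+ horner (v ∷ʳ a)
      ≡⟨ cong₂ (λ x y → b ℤ.* x ℤ.+ y) (ℤP.pos-* r (r ^ len)) (horner-∷ʳ v a) ⟩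
    b ℤ.* (+ r ℤ.* + (r ^ len)) ℤ.+ (horner v ℤ.* + r ℤ.+ a)
      ≡⟨ regroup b (+ r) (+ (r ^ len)) (horner v) a ⟩
    (b ℤ.* + (r ^ len) ℤ.+ horner v) ℤ.* + r ℤ.+ a ∎
    where
    open ≡-Reasoning
    regroup : ∀ b R P h a → b ℤ.* (R ℤ.* P) ℤ.+ (h ℤ.* R ℤ.+ a) ≡ (b ℤ.* P ℤ.+ h) ℤ.* R ℤ.+ a
    regroup = solve-∀

  horner-step : ∀ m l a h →
    (a ℚ./ 1) ℚ.* inv (r ^ m) ℚ.+ (h ℚ./ 1) ℚ.* inv (r ^ (m ℕ.+ l)) ≡
    ((a ℤ.* + (r ^ l) ℤ.+ h) ℚ./ 1) ℚ.* inv (r ^ (m ℕ.+ l))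
  horner-step m l a h = begin
    A ℚ.* inv (r ^ m) ℚ.+ H ℚ.* R ≡⟨ cong (λ x → A ℚ.* x ℚ.+ H ℚ.* R) split ⟩
    A ℚ.* (P ℚ.* R) ℚ.+ H ℚ.* R   ≡⟨ cong (ℚ._+ H ℚ.* R) (sym (ℚP.*-assoc A P R)) ⟩
    A ℚ.* P ℚ.* R ℚ.+ H ℚ.* R     ≡⟨ sym (ℚP.*-distribʳ-+ R (A ℚ.* P) H) ⟩
    (A ℚ.* P ℚ.+ H) ℚ.* R         ≡⟨ cong (λ x → (x ℚ.+ H) ℚ.* R) (/1-*-/ a (+ (r ^ l)) 1) ⟩
    ((a ℤ.* + (r ^ l)) ℚ./ 1 ℚ.+ H) ℚ.* R
      ≡⟨ cong (ℚ._* R) (/-+-/ (a ℤ.* + (r ^ l)) h 1) ⟩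
    ((a ℤ.* + (r ^ l) ℤ.+ h) ℚ./ 1) ℚ.* R ∎
    where
    open ≡-Reasoning
    A = a ℚ./ 1
    H = h ℚ./ 1
    P = + (r ^ l) ℚ./ 1
    R = inv (r ^ (m ℕ.+ l))
    split : inv (r ^ m) ≡ P ℚ.* R
    split = trans (inv-split (r ^ m) (r ^ l) {{ℕP.m^n≢0 r m}} {{ℕP.m^n≢0 r l}})
                  (cong (λ x → P ℚ.* inv x) (sym (ℕP.^-distribˡ-+-* r m l)))

  fracSum≡horner : ∀ k {len} (as : Vec ℤ len) →
                   fracSum r (suc k) as ≡ (horner as ℚ./ 1) ℚ.* inv (r ^ (k ℕ.+ len))
  fracSum≡horner k [] = sym (ℚP.*-zeroˡ (inv (r ^ (k ℕ.+ 0))))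
  fracSum≡horner k {suc len} (a ∷ as) = begin
    (a ℚ./ 1) ℚ.* inv (r ^ suc k) ℚ.+ fracSum r (suc (suc k)) as
      ≡⟨ cong ((a ℚ./ 1) ℚ.* inv (r ^ suc k) ℚ.+_) (fracSum≡horner (suc k) as) ⟩
    (a ℚ./ 1) ℚ.* inv (r ^ suc k) ℚ.+ (horner as ℚ./ 1) ℚ.* inv (r ^ (suc k ℕ.+ len))
      ≡⟨ horner-step (suc k) len a (horner as) ⟩
    (horner (a ∷ as) ℚ./ 1) ℚ.* inv (r ^ (suc k ℕ.+ len))
      ≡⟨ cong (λ x → (horner (a ∷ as) ℚ./ 1) ℚ.* inv (r ^ x)) (sym (ℕP.+-suc k len)) ⟩
    (horner (a ∷ as) ℚ./ 1) ℚ.* inv (r ^ (k ℕ.+ suc len)) ∎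
    where open ≡-Reasoning

  gfnValue≡horner : ∀ {n} (v : Vec ℤ (suc n)) → gfnValue r v ≡ (horner v ℚ./ 1) ℚ.* inv (r ^ n)
  gfnValue≡horner {n} (a ∷ as) = begin
    (a ℚ./ 1) ℚ.+ fracSum r 1 as
      ≡⟨ cong₂ ℚ._+_ (sym (ℚP.*-identityʳ (a ℚ./ 1))) (fracSum≡horner 0 as) ⟩
    (a ℚ./ 1) ℚ.* inv (r ^ 0) ℚ.+ (horner as ℚ./ 1) ℚ.* inv (r ^ (0 ℕ.+ n))
      ≡⟨ horner-step 0 n a (horner as) ⟩
    (horner (a ∷ as) ℚ./ 1) ℚ.* inv (r ^ n) ∎
    where open ≡-Reasoning

  -- A GFN code of x / rⁿ, described by its numerator x = Σ Aⱼ r^(n − j).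
  record IsScaledCode (n : ℕ) (x : ℤ) (v : Vec ℤ (suc n)) : Set where
    constructor isScaledCode
    field
      leading : LeadOK (head v)
      digits  : AllV (DigitOK r) (tail v)
      value   : horner v ≡ x

  IsScaledCode⇒IsGFNCode : ∀ {n m} {v : Vec ℤ (suc n)} →
                           IsScaledCode n (+ m) v → IsGFNCode r n (ratio m r n) v
  IsScaledCode⇒IsGFNCode {n} {v = a ∷ as} (isScaledCode lead ds value) =
    lead , ds , trans (gfnValue≡horner (a ∷ as)) (cong (λ x → (x ℚ./ 1) ℚ.* inv (r ^ n)) value)

  IsScaledCode-∷ʳ : ∀ {n x y a} {v : Vec ℤ (suc n)} →
    IsScaledCode n x v → DigitOK r a → x ℤ.* + r ℤ.+ a ≡ y → IsScaledCode (suc n) y (v ∷ʳ a)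
  IsScaledCode-∷ʳ {a = a} {v = a₀ ∷ as} (isScaledCode lead ds value) da eq =
    isScaledCode lead (AllV-∷ʳ ds da)
      (trans (horner-∷ʳ (a₀ ∷ as) a) (trans (cong (λ z → z ℤ.* + r ℤ.+ a) value) eq))

module Codes (s : ℕ) where

  -- With this encoding of r ≥ 2 the digit bound r ∸ 1 is definitionally suc s.
  r : ℕ
  r = suc (suc s)

  open Radix r

  -- The digit d + 1 − r that replaces the remainder d + 1 after borrowing r from the quotient.
  borrow : ℕ → ℤ
  borrow d = -[1+ (s ∸ d) ]

  r+borrow : ∀ {d} → d ℕ.≤ s → + r ℤ.+ borrow d ≡ + suc d
  r+borrow {d} d≤s = trans (ℤP.⊖-≥ (s≤s (ℕP.≤-trans (ℕP.m∸n≤m s d) (ℕP.n≤1+n s))))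
    (cong +_ (trans (ℕP.+-∸-assoc 1 (ℕP.m∸n≤m s d)) (cong suc (ℕP.m∸[m∸n]≡n d≤s))))

  digit-0 : DigitOK r (+ 0)
  digit-0 = -≤+ , +≤+ z≤n

  digit-suc : ∀ {d} → d ℕ.≤ s → DigitOK r (+ suc d)
  digit-suc d≤s = -≤+ , +≤+ (s≤s d≤s)

  digit-borrow : ∀ d → DigitOK r (borrow d)
  digit-borrow d = -≤- (ℕP.m∸n≤m s d) , -≤+

  +q*r+d : ∀ q d → + q ℤ.* + r ℤ.+ + d ≡ + (d ℕ.+ q ℕ.* r)
  +q*r+d q d = trans (cong (ℤ._+ + d) (sym (ℤP.pos-* q r)))
    (trans (sym (ℤP.pos-+ (q ℕ.* r) d)) (cong +_ (ℕP.+-comm (q ℕ.* r) d)))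

  +[1+q]*r+borrow : ∀ q {d} → d ℕ.≤ s → + suc q ℤ.* + r ℤ.+ borrow d ≡ + (suc d ℕ.+ q ℕ.* r)
  +[1+q]*r+borrow q {d} d≤s = begin
    (+ 1 ℤ.+ + q) ℤ.* + r ℤ.+ borrow d ≡⟨ carry (+ q) (+ r) (borrow d) ⟩
    + q ℤ.* + r ℤ.+ (+ r ℤ.+ borrow d) ≡⟨ cong (λ x → + q ℤ.* + r ℤ.+ x) (r+borrow d≤s) ⟩
    + q ℤ.* + r ℤ.+ + suc d            ≡⟨ +q*r+d q (suc d) ⟩
    + (suc d ℕ.+ q ℕ.* r)              ∎
    where
    open ≡-Reasoning
    carry : ∀ Q R b → (+ 1 ℤ.+ Q) ℤ.* R ℤ.+ b ≡ Q ℤ.* R ℤ.+ (R ℤ.+ b)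
    carry = solve-∀

  appendDigit : ∀ {k} → ℕ → List (Vec ℤ k) → List (Vec ℤ k) → List (Vec ℤ (suc k))
  appendDigit zero    cs _   = map (_∷ʳ + 0) cs
  appendDigit (suc d) cs cs⁺ = map (_∷ʳ + suc d) cs ++ map (_∷ʳ borrow d) cs⁺

  codes : (n x : ℕ) → List (Vec ℤ (suc n))
  codes zero    zero          = [ + 0 ∷ [] ]
  codes zero    (suc zero)    = [ + 1 ∷ [] ]
  codes zero    (suc (suc _)) = []
  codes (suc n) x             = appendDigit (x % r) (codes n (x / r)) (codes n (suc (x / r)))

  appendDigit-scaledCodes : ∀ {n q} {cs cs⁺ : List (Vec ℤ (suc n))} d → d < r →
    All (IsScaledCode n (+ q)) cs → All (IsScaledCode n (+ suc q)) cs⁺ →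
    All (IsScaledCode (suc n) (+ (d ℕ.+ q ℕ.* r))) (appendDigit d cs cs⁺)
  appendDigit-scaledCodes {q = q} zero _ cs-ok _ =
    All.map⁺ (All.map (λ c → IsScaledCode-∷ʳ c digit-0 (+q*r+d q 0)) cs-ok)
  appendDigit-scaledCodes {q = q} (suc d) (s≤s (s≤s d≤s)) cs-ok cs⁺-ok = All.++⁺
    (All.map⁺ (All.map (λ c → IsScaledCode-∷ʳ c (digit-suc d≤s) (+q*r+d q (suc d))) cs-ok))
    (All.map⁺ (All.map (λ c → IsScaledCode-∷ʳ c (digit-borrow d) (+[1+q]*r+borrow q d≤s)) cs⁺-ok))

  codes-scaledCodes : ∀ n x → All (IsScaledCode n (+ x)) (codes n x)
  codes-scaledCodes zero    zero          = isScaledCode (inj₁ refl) [] refl All.∷ All.[]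
  codes-scaledCodes zero    (suc zero)    = isScaledCode (inj₂ refl) [] refl All.∷ All.[]
  codes-scaledCodes zero    (suc (suc _)) = All.[]
  codes-scaledCodes (suc n) x =
    subst (λ y → All (IsScaledCode (suc n) (+ y)) (codes (suc n) x)) (sym (m≡m%n+[m/n]*n x r))
      (appendDigit-scaledCodes (x % r) (m%n<n x r)
        (codes-scaledCodes n (x / r)) (codes-scaledCodes n (suc (x / r))))

  map-∷ʳ-unique : ∀ {k} {cs : List (Vec ℤ k)} a → Unique cs → Unique (map (_∷ʳ a) cs)
  map-∷ʳ-unique a = Unique.map⁺ (λ {v} {w} → ∷ʳ-injectiveˡ v w)

  appendDigit-unique : ∀ {k} {cs cs⁺ : List (Vec ℤ k)} d →
                       Unique cs → Unique cs⁺ → Unique (appendDigit d cs cs⁺)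
  appendDigit-unique zero u _ = map-∷ʳ-unique (+ 0) u
  appendDigit-unique {cs = cs} {cs⁺} (suc d) u u⁺ =
    Unique.++⁺ (map-∷ʳ-unique (+ suc d) u) (map-∷ʳ-unique (borrow d) u⁺) disjoint
    where
    disjoint : Disjoint (map (_∷ʳ + suc d) cs) (map (_∷ʳ borrow d) cs⁺)
    disjoint (v∈ , v∈⁺) with ∈-map⁻ (_∷ʳ + suc d) v∈ | ∈-map⁻ (_∷ʳ borrow d) v∈⁺
    ... | v , _ , refl | w , _ , eq with ∷ʳ-injectiveʳ v w eq
    ... | ()

  codes-unique : ∀ n x → Unique (codes n x)
  codes-unique zero    zero          = All.[] AllPairs.∷ AllPairs.[]
  codes-unique zero    (suc zero)    = All.[] AllPairs.∷ AllPairs.[]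
  codes-unique zero    (suc (suc _)) = AllPairs.[]
  codes-unique (suc n) x =
    appendDigit-unique (x % r) (codes-unique n (x / r)) (codes-unique n (suc (x / r)))

  length-appendDigit : ∀ {k} {cs cs⁺ : List (Vec ℤ k)} d → d ≢ 0 →
                       length (appendDigit d cs cs⁺) ≡ length cs ℕ.+ length cs⁺
  length-appendDigit zero    d≢0 = ⊥-elim (d≢0 refl)
  length-appendDigit {cs = cs} {cs⁺} (suc d) _ =
    trans (length-++ (map (_∷ʳ + suc d) cs)) (cong₂ ℕ._+_ (length-map _ cs) (length-map _ cs⁺))

  length-appendDigit-≥ : ∀ {k} {cs cs⁺ : List (Vec ℤ k)} d →
                         length cs ≤ length (appendDigit d cs cs⁺)
  length-appendDigit-≥ {cs = cs} zero = ℕP.≤-reflexive (sym (length-map _ cs))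
  length-appendDigit-≥ {cs = cs} {cs⁺} (suc d) =
    subst (length cs ≤_) (sym (length-appendDigit {cs = cs} {cs⁺} (suc d) (λ ())))
      (ℕP.m≤m+n (length cs) (length cs⁺))

  codes-nonempty : ∀ n x → x ≤ r ^ n → 1 ≤ length (codes n x)
  codes-nonempty zero    zero          _         = s≤s z≤n
  codes-nonempty zero    (suc zero)    _         = s≤s z≤n
  codes-nonempty zero    (suc (suc _)) (s≤s ())
  codes-nonempty (suc n) x             x≤ =
    ℕP.≤-trans (codes-nonempty n (x / r) (/-≤-^ r n x≤)) (length-appendDigit-≥ (x % r))

  ∣⇒∤suc : ∀ {q} → r ∣ q → ¬ r ∣ suc q
  ∣⇒∤suc {q} r∣q r∣1+q with ∣1⇒≡1 (∣m+n∣m⇒∣n (subst (r ∣_) (ℕP.+-comm 1 q) r∣1+q) r∣q)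
  ... | ()

  codes-length : ∀ n x → x ≤ r ^ n → ¬ r ∣ x → suc n ≤ length (codes n x)

  codes-length-consecutive : ∀ n q → q < r ^ n →
                             suc (suc n) ≤ length (codes n q) ℕ.+ length (codes n (suc q))
  codes-length-consecutive n q q< with r ∣? q
  ... | yes r∣q = ℕP.+-mono-≤ (codes-nonempty n q (ℕP.<⇒≤ q<)) (codes-length n (suc q) q< (∣⇒∤suc r∣q))
  ... | no  r∤q = ℕP.≤-trans
    (ℕP.+-mono-≤ (codes-nonempty n (suc q) q<) (codes-length n q (ℕP.<⇒≤ q<) r∤q))
    (ℕP.≤-reflexive (ℕP.+-comm (length (codes n (suc q))) (length (codes n q))))

  codes-length zero    zero          _        _ = s≤s z≤n
  codes-length zero    (suc zero)    _        _ = s≤s z≤n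
  codes-length zero    (suc (suc _)) (s≤s ()) _
  codes-length (suc n) x x≤ r∤x =
    subst (suc (suc n) ≤_) (sym (length-appendDigit (x % r) (r∤x ∘ m%n≡0⇒n∣m x r)))
      (codes-length-consecutive n (x / r) (/-<-^ r n (≤-^-∤⇒<-^ n x≤ r∤x)))

corollary1 : (r n m : ℕ) → 2 ≤ r → 1 ≤ n → 1 ≤ m → m ≤ r ^ n ∸ 1 → ¬ (r ∣ m) →
    Σ (List (Vec ℤ (suc n))) λ codes →
      Unique codes × All (IsGFNCode r n (ratio m r n)) codes × suc n ≤ length codes
corollary1 (suc (suc s)) n m (s≤s (s≤s z≤n)) _ _ m≤ r∤m =
  codes n m , codes-unique n m , All.map IsScaledCode⇒IsGFNCode (codes-scaledCodes n m) ,
  codes-length n m (ℕP.≤-trans m≤ (ℕP.m∸n≤m _ 1)) r∤m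
  where
  open Codes s
  open Radix r
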